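{- Let $E$ be a finite set and let $\mathcal{W}\subseteq\{+,-,0\}^E$ satisfy (A1) if $X,Y\in\mathcal{W}$ then $X\circ Y\in\mathcal{W}$ and $X\circ(-Y)\in\mathcal{W}$; (A2) if $X,Y\in\mathcal{W}$ with $\underline{X}=\underline{Y}$, then $I_e(X,Y)\cap\mathcal{W}\neq\emptyset$ for all $e\in S(X,Y)$; (A3) $P\circ W\in\mathcal{W}$ for all $P\in\mathcal{P}(\mathcal{W})$, $W\in\mathcal{W}$. Let $U,U'\in\mathrm{asym}(\mathcal{W})$ with $\underline{U}=\underline{U'}$ and $I(U,-U')\cap\mathcal{W}=I(-U,U')\cap\mathcal{W}=\emptyset$, and let $P=U+(-U')$ (so $P\in\mathcal{P}(\mathcal{W})$). Then for every $Z\in\mathcal{W}$ with $\underline{Z}\subseteq\underline{U}$ we have $Z_f=U_f$ for all $f\in\underline{U}-\underline{P}$.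
   Context: A sign vector on a finite set $E$ is $X\in\{+,-,0\}^E$ with support $\underline{X}=\{e: X_e\neq0\}$; $-X$ swaps $+$ and $-$; composition $(X\circ Y)_e=X_e$ if $X_e\neq0$, else $Y_e$; $S(X,Y)=\{e: X_e,Y_e\neq0, X_e\neq Y_e\}$; sum $(X+Y)_e=0$ if $e\in S(X,Y)$ and $(X\circ Y)_e$ otherwise. For $X\neq Y$ with $\underline{X}=\underline{Y}$ and $e\in S(X,Y)$: $I_e(X,Y)=\{V : \underline{V}\subseteq\underline{X}-\{e\},\ V_f=X_f \text{ for all } f\notin S(X,Y)\}$, $I(X,Y)=\bigcup_{e\in S(X,Y)}I_e(X,Y)$. $\mathrm{sym}(\mathcal{W})=\{V: V,-V\in\mathcal{W}\}$, $\mathrm{asym}(\mathcal{W})=\mathcal{W}-\mathrm{sym}(\mathcal{W})$, $\mathcal{P}(\mathcal{W})=\{X+(-Y): X,Y\in\mathrm{asym}(\mathcal{W}),\ \underline{X}=\underline{Y},\ I(X,-Y)\cap\mathcal{W}=I(-X,Y)\cap\mathcal{W}=\emptyset\}$. -}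

module Defs where

open import Data.Nat using (ℕ)
open import Data.Fin using (Fin)
open import Data.Product using (Σ; _×_; _,_)
open import Data.Empty using (⊥)
open import Relation.Nullary using (¬_)
open import Relation.Binary.PropositionalEquality using (_≡_; _≢_)

data Sign : Set where
  plus minus zero : Sign

SignVec : ℕ → Set
SignVec n = Fin n → Sign

negS : Sign → Sign
negS plus  = minus
negS minus = plus
negS zero  = zero

neg : ∀ {n} → SignVec n → SignVec n
neg X e = negS (X e)

compS : Sign → Sign → Sign
compS zero  b = b
compS plus  _ = plus
compS minus _ = minus

_∘ₛ_ : ∀ {n} → SignVec n → SignVec n → SignVec n
(X ∘ₛ Y) e = compS (X e) (Y e)

sumS : Sign → Sign → Sign
sumS plus  minus = zero
sumS minus plus  = zero
sumS a     b     = compS a b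

_+ₛ_ : ∀ {n} → SignVec n → SignVec n → SignVec n
(X +ₛ Y) e = sumS (X e) (Y e)

InSupp : ∀ {n} → SignVec n → Fin n → Set
InSupp X e = X e ≢ zero

SameSupp : ∀ {n} → SignVec n → SignVec n → Set
SameSupp X Y = ∀ e → (InSupp X e → InSupp Y e) × (InSupp Y e → InSupp X e)

SuppSub : ∀ {n} → SignVec n → SignVec n → Set
SuppSub X Y = ∀ e → InSupp X e → InSupp Y e

InSep : ∀ {n} → SignVec n → SignVec n → Fin n → Set
InSep X Y e = InSupp X e × InSupp Y e × X e ≢ Y e

InIe : ∀ {n} → SignVec n → SignVec n → Fin n → SignVec n → Set
InIe X Y e V =
  (∀ f → InSupp V f → InSupp X f × f ≢ e) ×
  (∀ f → ¬ InSep X Y f → V f ≡ X f)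

InI : ∀ {n} → SignVec n → SignVec n → SignVec n → Set
InI X Y V = Σ _ λ e → InSep X Y e × InIe X Y e V

SVSet : ℕ → Set₁
SVSet n = SignVec n → Set

IDisjoint : ∀ {n} → SVSet n → SignVec n → SignVec n → Set
IDisjoint 𝒲 X Y = ∀ V → InI X Y V → ¬ 𝒲 V

InSym : ∀ {n} → SVSet n → SignVec n → Set
InSym 𝒲 V = 𝒲 V × 𝒲 (neg V)

InAsym : ∀ {n} → SVSet n → SignVec n → Set
InAsym 𝒲 V = 𝒲 V × ¬ InSym 𝒲 V

InP : ∀ {n} → SVSet n → SignVec n → Set
InP 𝒲 P = Σ _ λ X → Σ _ λ Y →
  InAsym 𝒲 X × InAsym 𝒲 Y × SameSupp X Y ×
  IDisjoint 𝒲 X (neg Y) × IDisjoint 𝒲 (neg X) Y ×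
  P ≡ (X +ₛ neg Y)

A1 : ∀ {n} → SVSet n → Set
A1 𝒲 = ∀ X Y → 𝒲 X → 𝒲 Y → 𝒲 (X ∘ₛ Y) × 𝒲 (X ∘ₛ neg Y)

A2 : ∀ {n} → SVSet n → Set
A2 𝒲 = ∀ X Y → 𝒲 X → 𝒲 Y → SameSupp X Y →
  ∀ e → InSep X Y e → Σ _ λ V → InIe X Y e V × 𝒲 V

A3 : ∀ {n} → SVSet n → Set
A3 𝒲 = ∀ P W → InP 𝒲 P → 𝒲 W → 𝒲 (P ∘ₛ W)

-- Suppose Z_f ≠ U_f.  The vector Y = P ∘ (Z ∘ −U) lies in 𝒲 by (A1) and (A3),
-- has the support of U, agrees with U wherever P ≠ 0 (so S(U,Y) ⊆ S(U,−U′)),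
-- and differs from U at f.  By (A2) some member of 𝒲 lies in
-- I_f(U,Y) ⊆ I_f(U,−U′), contradicting I(U,−U′) ∩ 𝒲 = ∅.
module Submission where

open import Defs
open import Data.Nat using (ℕ)
open import Data.Fin using (Fin)
open import Data.Product using (_×_; _,_; proj₁; proj₂)
open import Data.Empty using (⊥-elim)
open import Relation.Nullary using (¬_; yes; no)
open import Relation.Nullary.Decidable using (decidable-stable)
open import Relation.Binary.Definitions using (DecidableEquality)
open import Relation.Binary.PropositionalEquality using (_≡_; _≢_; refl)

_≟ˢ_ : DecidableEquality Sign
plus  ≟ˢ plus  = yes refl
plus  ≟ˢ minus = no λ ()
plus  ≟ˢ zero  = no λ ()
minus ≟ˢ plus  = no λ ()
minus ≟ˢ minus = yes refl
minus ≟ˢ zero  = no λ ()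
zero  ≟ˢ plus  = no λ ()
zero  ≟ˢ minus = no λ ()
zero  ≟ˢ zero  = yes refl

¬nonzero⇒zero : ∀ s → ¬ s ≢ zero → s ≡ zero
¬nonzero⇒zero s = decidable-stable (s ≟ˢ zero)

InIe-mono : ∀ {n} {X Y Y′ : SignVec n} {e V} →
  (∀ g → InSep X Y g → InSep X Y′ g) → InIe X Y e V → InIe X Y′ e V
InIe-mono sep⊆ (supp⊆ , agree) = supp⊆ , λ g g∉S′ → agree g (λ g∈S → g∉S′ (sep⊆ g g∈S))

A2⇒¬IDisjoint : ∀ {n} {𝒲 : SVSet n} {X Y Y′ e} → A2 𝒲 →
  𝒲 X → 𝒲 Y → SameSupp X Y → InSep X Y e →
  (∀ g → InSep X Y g → InSep X Y′ g) → ¬ IDisjoint 𝒲 X Y′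
A2⇒¬IDisjoint {e = e} a2 wX wY ss e∈S sep⊆ disjoint
  with a2 _ _ wX wY ss e e∈S
... | V , V∈Ie , wV = disjoint V (e , sep⊆ e e∈S , InIe-mono sep⊆ V∈Ie) wV

-- The coordinate of (U + −U′) ∘ (Z ∘ −U) at a point where U, U′, Z take the values a, b, c.
realign : Sign → Sign → Sign → Sign
realign a b c = compS (sumS a (negS b)) (compS c (negS a))

realign-nonzero : ∀ a b c → a ≢ zero → realign a b c ≢ zero
realign-nonzero zero  _     _     a≢0 = ⊥-elim (a≢0 refl)
realign-nonzero plus  plus  plus  _   = λ ()
realign-nonzero plus  plus  minus _   = λ ()
realign-nonzero plus  plus  zero  _   = λ ()
realign-nonzero plus  minus _     _   = λ ()
realign-nonzero plus  zero  _     _   = λ ()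
realign-nonzero minus plus  _     _   = λ ()
realign-nonzero minus minus plus  _   = λ ()
realign-nonzero minus minus minus _   = λ ()
realign-nonzero minus minus zero  _   = λ ()
realign-nonzero minus zero  _     _   = λ ()

realign-zero : ∀ {a b c} → a ≡ zero → b ≡ zero → c ≡ zero → realign a b c ≡ zero
realign-zero refl refl refl = refl

realign-sep : ∀ a b c → (a ≢ zero → b ≢ zero) → a ≢ zero → a ≢ realign a b c →
  negS b ≢ zero × a ≢ negS b
realign-sep zero  _     _ _   a≢0 _   = ⊥-elim (a≢0 refl)
realign-sep plus  plus  _ _   _   _   = (λ ()) , (λ ())
realign-sep plus  minus _ _   _   a≢y = ⊥-elim (a≢y refl)
realign-sep plus  zero  _ b≢0 a≢0 _   = ⊥-elim (b≢0 a≢0 refl)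
realign-sep minus plus  _ _   _   a≢y = ⊥-elim (a≢y refl)
realign-sep minus minus _ _   _   _   = (λ ()) , (λ ())
realign-sep minus zero  _ b≢0 a≢0 _   = ⊥-elim (b≢0 a≢0 refl)

realign-cancelled : ∀ a b c → a ≢ zero → sumS a (negS b) ≡ zero → c ≢ a → a ≢ realign a b c
realign-cancelled zero  _     _     a≢0 _  _   = ⊥-elim (a≢0 refl)
realign-cancelled plus  plus  plus  _   _  c≢a = ⊥-elim (c≢a refl)
realign-cancelled plus  plus  minus _   _  _   = λ ()
realign-cancelled plus  plus  zero  _   _  _   = λ ()
realign-cancelled minus minus plus  _   _  _   = λ ()
realign-cancelled minus minus minus _   _  c≢a = ⊥-elim (c≢a refl)
realign-cancelled minus minus zero  _   _  _   = λ ()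
realign-cancelled plus  minus _     _   () _
realign-cancelled plus  zero  _     _   () _
realign-cancelled minus plus  _     _   () _
realign-cancelled minus zero  _     _   () _

module _ {n} {U U′ Z : SignVec n} (ss : SameSupp U U′) where

  private
    Y : SignVec n
    Y = (U +ₛ neg U′) ∘ₛ (Z ∘ₛ neg U)

  sameSupp-realign : SuppSub Z U → SameSupp U Y
  sameSupp-realign Z⊆U g =
      realign-nonzero (U g) (U′ g) (Z g)
    , λ y≢0 u≡0 → y≢0 (realign-zero u≡0
        (¬nonzero⇒zero (U′ g) λ u′≢0 → proj₂ (ss g) u′≢0 u≡0)
        (¬nonzero⇒zero (Z g) λ z≢0 → Z⊆U g z≢0 u≡0))

  sep-realign⊆sep : ∀ g → InSep U Y g → InSep U (neg U′) g
  sep-realign⊆sep g (u≢0 , _ , u≢y) = u≢0 , realign-sep (U g) (U′ g) (Z g) (proj₁ (ss g)) u≢0 u≢y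

  cancelled∈sep-realign : ∀ {f} → InSupp U f → ¬ InSupp (U +ₛ neg U′) f → Z f ≢ U f → InSep U Y f
  cancelled∈sep-realign {f} u≢0 p≡0 z≢u =
      u≢0
    , realign-nonzero (U f) (U′ f) (Z f) u≢0
    , realign-cancelled (U f) (U′ f) (Z f) u≢0 (¬nonzero⇒zero _ p≡0) z≢u

lemma2p4 : (n : ℕ) (𝒲 : SVSet n) → A1 𝒲 → A2 𝒲 → A3 𝒲 →
    (U U′ : SignVec n) → InAsym 𝒲 U → InAsym 𝒲 U′ → SameSupp U U′ →
    IDisjoint 𝒲 U (neg U′) → IDisjoint 𝒲 (neg U) U′ →
    (Z : SignVec n) → 𝒲 Z → SuppSub Z U →
    (f : Fin n) → InSupp U f → ¬ InSupp (U +ₛ neg U′) f → Z f ≡ U f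
lemma2p4 n 𝒲 a1 a2 a3 U U′ asU asU′ ss d₁ d₂ Z wZ Z⊆U f u≢0 p≡0 with Z f ≟ˢ U f
... | yes z≡u = z≡u
... | no  z≢u = ⊥-elim (A2⇒¬IDisjoint a2 (proj₁ asU) wY
                  (sameSupp-realign ss Z⊆U)
                  (cancelled∈sep-realign {Z = Z} ss u≢0 p≡0 z≢u)
                  (sep-realign⊆sep {Z = Z} ss) d₁)
  where
  P∈𝒫 : InP 𝒲 (U +ₛ neg U′)
  P∈𝒫 = U , U′ , asU , asU′ , ss , d₁ , d₂ , refl

  wY : 𝒲 ((U +ₛ neg U′) ∘ₛ (Z ∘ₛ neg U))
  wY = a3 _ _ P∈𝒫 (proj₂ (a1 Z U wZ (proj₁ asU)))
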